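{- Let $\mathcal{C}$ be an $(m,n,r)$-scheme and $X,Y,Z\in\mathrm{Fib}(\mathcal{C})$. If $T\in\mathcal{R}_{X,Y}$ is such that $d_T$ is coprime to $\prod_{R\in\mathcal{R}_{Y,Z}}d_R$, then the multiset $d_{Y,Z}$ coincides with the multiset $d_{X,Z}$, and $d_T\le\min\{d_R: R\in\mathcal{R}_{Y,Z}\}$.
   Context: A scheme is a pair $\mathcal{C}=(V,\mathcal{R})$, $V$ finite, $\mathcal{R}$ a partition of $V\times V$ into nonempty relations such that $\Delta_V$ is a union of members of $\mathcal{R}$, $\mathcal{R}$ is closed under transposition, and for $R,S,T\in\mathcal{R}$ the number of $w$ with $(u,w)\in R,(w,v)\in S$ is the same for all $(u,v)\in T$. A fiber is a nonempty $X\subseteq V$ with $\Delta_X\in\mathcal{R}$; $\mathrm{Fib}(\mathcal{C})$ is the set of fibers; $\mathcal{R}_{X,Y}=\{R\in\mathcal{R}:R\subseteq X\times Y\}$. An $(m,n,r)$-scheme is one with $|\mathcal{R}_{X,Y}|=r$ for all fibers $X,Y$, $|X|=m$ for every fiber, and $n$ fibers. For $R\in\mathcal{R}_{X,Y}$, $d_R=|\{y:(x,y)\in R\}|$ for any $x\in X$. For fibers $X,Y$, $d_{X,Y}$ is the multiset $\{d_R: R\in\mathcal{R}_{X,Y}\}$. -}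

module Defs where

open import Data.Nat using (ℕ)
open import Data.Fin using (Fin)
open import Data.Fin.Properties using (all?; any?) renaming (_≟_ to _≟ᶠ_)
open import Data.List using (List; length; filter; map)
open import Data.List.Base using (allFin)
open import Data.Product using (_×_; _,_; ∃; proj₁; proj₂)
open import Relation.Binary.PropositionalEquality using (_≡_)
open import Relation.Nullary using (Dec; yes; no)
open import Relation.Nullary.Decidable using (_×-dec_; _→-dec_)

-- A coherent configuration ("scheme") on the point set V = Fin N whose
-- relations are indexed by Fin K: the relation with index k is the colour
-- class { (u , v) | col u v ≡ k }.
module _ {N K : ℕ} (col : Fin N → Fin N → Fin K) where

  interNum : Fin K → Fin K → Fin N → Fin N → ℕ
  interNum R S u v =
    length (filter (λ w → (col u w ≟ᶠ R) ×-dec (col w v ≟ᶠ S)) (allFin N))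

record Scheme (N K : ℕ) : Set where
  field
    col   : Fin N → Fin N → Fin K
    surj  : ∀ k → ∃ λ (p : Fin N × Fin N) → col (proj₁ p) (proj₂ p) ≡ k
    -- Δ_V is a union of relations: a relation containing a diagonal pair
    -- consists of diagonal pairs only
    diag  : ∀ u v w → col u v ≡ col w w → u ≡ v
    tr        : Fin K → Fin K
    transpose : ∀ u v → col v u ≡ tr (col u v)
    regular : ∀ R S T u v u′ v′ → col u v ≡ T → col u′ v′ ≡ T →
              interNum col R S u v ≡ interNum col R S u′ v′

module _ {N K : ℕ} (C : Scheme N K) where
  open Scheme C

  -- The relation k is Δ_X for a fiber X = { x | col x x ≡ k }
  -- (fibers are identified with the indices of their diagonal relations).
  IsFiber : Fin K → Set
  IsFiber k = ∃ λ (x : Fin N) → col x x ≡ k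

  isFiber? : ∀ k → Dec (IsFiber k)
  isFiber? k = any? (λ x → col x x ≟ᶠ k)

  fibers : List (Fin K)
  fibers = filter isFiber? (allFin K)

  fiberSize : Fin K → ℕ
  fiberSize X = length (filter (λ x → col x x ≟ᶠ X) (allFin N))

  InRel : Fin K → Fin K → Fin K → Set
  InRel X Y R = ∀ u v → col u v ≡ R → (col u u ≡ X) × (col v v ≡ Y)

  inRel? : ∀ X Y R → Dec (InRel X Y R)
  inRel? X Y R = all? (λ u → all? (λ v →
    (col u v ≟ᶠ R) →-dec ((col u u ≟ᶠ X) ×-dec (col v v ≟ᶠ Y))))

  rels : Fin K → Fin K → List (Fin K)
  rels X Y = filter (inRel? X Y) (allFin K)

  -- d_R = |{ y | (x , y) ∈ R }| for a point x of the source fiber of R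
  -- (x taken from a chosen pair of R; by the scheme axioms it does not
  -- depend on the choice)
  d : Fin K → ℕ
  d R = length (filter (λ y → col x y ≟ᶠ R) (allFin N))
    where x = proj₁ (proj₁ (surj R))

  dMulti : Fin K → Fin K → List ℕ
  dMulti X Y = map d (rels X Y)

  record IsMNR (m n r : ℕ) : Set where
    field
      relCount  : ∀ X Y → IsFiber X → IsFiber Y → length (rels X Y) ≡ r
      fiberCard : ∀ X → IsFiber X → fiberSize X ≡ m
      fiberNum  : length fibers ≡ n

-- Count triangles x →T w →R z with (x,z) ∈ S in three ways:
--   p^R_{T*S} |R| = p^T_{S R*} |T| = p^S_{TR} |S|,
-- where |A| = m d_A for every relation A between fibers of size m.  Hence
-- d_R p^R_{T*S} = t p^T_{S R*}; coprimality and p^R_{T*S} ≤ t force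
-- p^R_{T*S} ∈ {0, t}, and since these numbers sum to t over S, each R ∈ ℛ_{Y,Z}
-- has exactly one partner S ∈ ℛ_{X,Z} with p^R_{T*S} = t.  The 0/1 matrix of
-- partners expresses every d_S (S ∈ ℛ_{X,Z}) as a sum of valencies d_R; as
-- |ℛ_{Y,Z}| = |ℛ_{X,Z}| = r, a counting argument shows it is a permutation
-- matrix with d_S = d_R for partners, giving the multiset equality.  For
-- partners, t d_R = d_S p^S_{TR} yields t = p^S_{TR} ≤ d_R.
module Submission where

open import Defs
open import Data.Nat using (ℕ; zero; suc; _+_; _*_; _≤_; _≟_; z≤n; s≤s; NonZero; >-nonZero; ≢-nonZero⁻¹)
open import Data.Nat.Properties
open import Data.Nat.Coprimality using (Coprime; coprime-divisor)
open import Data.Nat.Divisibility using (divides; ∣-trans; ∣⇒≤)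
open import Data.Nat.ListAction using (product)
open import Data.Nat.ListAction.Properties using (∈⇒∣product)
open import Algebra.Properties.Semiring.Sum +-*-semiring
  using (sum; sum-syntax; sum-cong-≗; sum-replicate-zero; ∑-comm; *-distribˡ-sum; *-distribʳ-sum)
open import Algebra.Properties.CommutativeSemigroup +-commutativeSemigroup using (x∙yz≈y∙xz)
open import Algebra.Properties.CommutativeSemigroup *-commutativeSemigroup as *-Comm
  using ()
open import Data.Fin using (Fin; zero; suc)
open import Data.Fin.Properties using () renaming (_≟_ to _≟ᶠ_; suc-injective to fin-suc-injective)
open import Data.Bool using (true; false; if_then_else_)
open import Data.List using (List; []; _∷_; _++_; length; filter; tabulate; map)
open import Data.List.Base using (allFin)
open import Data.List.Membership.Propositional using (_∈_)
open import Data.List.Membership.Propositional.Properties using (∈-∃++; ∈-filter⁻; ∈-filter⁺; ∈-map⁺; ∈-allFin)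
open import Data.List.Relation.Unary.Any using (here; there)
open import Data.List.Relation.Binary.Permutation.Propositional using (_↭_; ↭-refl; ↭-sym; ↭-trans; prep)
open import Data.List.Relation.Binary.Permutation.Propositional.Properties using (shift)
open import Data.Product using (_×_; _,_; ∃; proj₁; proj₂)
open import Data.Sum using (_⊎_; inj₁; inj₂)
open import Data.Empty using (⊥-elim)
open import Function using (_∘_)
open import Relation.Binary.PropositionalEquality
open import Relation.Nullary using (Dec; yes; no; does; ¬_)
open import Relation.Nullary.Decidable using (_×-dec_)
open import Relation.Unary using (Pred; Decidable)

sum-zero : ∀ {n} {f : Fin n → ℕ} → (∀ i → f i ≡ 0) → sum f ≡ 0
sum-zero {n} h = trans (sum-cong-≗ h) (sum-replicate-zero n)

term≤sum : ∀ {n} (f : Fin n → ℕ) (j : Fin n) → f j ≤ sum f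
term≤sum f zero    = m≤m+n _ _
term≤sum f (suc j) = ≤-trans (term≤sum (f ∘ suc) j) (m≤n+m _ _)

two-terms≤sum : ∀ {n} (f : Fin n → ℕ) (i j : Fin n) → i ≢ j → f i + f j ≤ sum f
two-terms≤sum f zero    zero    i≢j = ⊥-elim (i≢j refl)
two-terms≤sum f zero    (suc j) i≢j = +-monoʳ-≤ (f zero) (term≤sum (f ∘ suc) j)
two-terms≤sum f (suc i) zero    i≢j =
  subst (_≤ sum f) (+-comm (f zero) (f (suc i))) (+-monoʳ-≤ (f zero) (term≤sum (f ∘ suc) i))
two-terms≤sum f (suc i) (suc j) i≢j =
  ≤-trans (two-terms≤sum (f ∘ suc) i j (i≢j ∘ cong suc)) (m≤n+m _ (f zero))

sum≡0⇒term≡0 : ∀ {n} (f : Fin n → ℕ) → sum f ≡ 0 → ∀ j → f j ≡ 0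
sum≡0⇒term≡0 f s j = n≤0⇒n≡0 (subst (f j ≤_) s (term≤sum f j))

nonzero-term : ∀ {n} (f : Fin n → ℕ) → sum f ≢ 0 → ∃ λ j → f j ≢ 0
nonzero-term {zero}  f s≢0 = ⊥-elim (s≢0 refl)
nonzero-term {suc n} f s≢0 with f zero ≟ 0
... | no f0≢0 = zero , f0≢0
... | yes f0≡0 with nonzero-term (f ∘ suc) (λ s′ → s≢0 (cong₂ _+_ f0≡0 s′))
...   | j , fj≢0 = suc j , fj≢0

sum-mono : ∀ {n} {f g : Fin n → ℕ} → (∀ i → f i ≤ g i) → sum f ≤ sum g
sum-mono {zero}  f≤g = z≤n
sum-mono {suc n} f≤g = +-mono-≤ (f≤g zero) (sum-mono (f≤g ∘ suc))

sum-mono-≡ : ∀ {n} {f g : Fin n → ℕ} → (∀ i → f i ≤ g i) → sum f ≡ sum g → ∀ i → f i ≡ g i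
sum-mono-≡ {suc n} {f} {g} f≤g s zero    = ≤-antisym (f≤g zero) g0≤f0
  where
  g0≤f0 : g zero ≤ f zero
  g0≤f0 = +-cancelʳ-≤ (sum (f ∘ suc)) (g zero) (f zero)
    (≤-trans (+-monoʳ-≤ (g zero) (sum-mono (f≤g ∘ suc))) (≤-reflexive (sym s)))
sum-mono-≡ {suc n} {f} {g} f≤g s (suc i) = sum-mono-≡ (f≤g ∘ suc) tails i
  where
  tails : sum (f ∘ suc) ≡ sum (g ∘ suc)
  tails = +-cancelˡ-≡ (f zero) _ _
    (trans s (cong (_+ sum (g ∘ suc)) (sym (sum-mono-≡ f≤g s zero))))

sum-single : ∀ {n} (f : Fin n → ℕ) (j : Fin n) → (∀ i → i ≢ j → f i ≡ 0) → sum f ≡ f j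
sum-single f zero    others =
  trans (cong (f zero +_) (sum-zero (λ i → others (suc i) λ ()))) (+-identityʳ _)
sum-single f (suc j) others =
  trans (cong (_+ sum (f ∘ suc)) (others zero λ ()))
        (sum-single (f ∘ suc) j (λ i i≢j → others (suc i) (i≢j ∘ fin-suc-injective)))

𝟙 : ∀ {p} {P : Set p} → Dec P → ℕ
𝟙 P? = if does P? then 1 else 0

module _ {p} {P : Set p} where

  𝟙-yes : (P? : Dec P) → P → 𝟙 P? ≡ 1
  𝟙-yes (yes _) _  = refl
  𝟙-yes (no ¬p) p′ = ⊥-elim (¬p p′)

  𝟙-no : (P? : Dec P) → ¬ P → 𝟙 P? ≡ 0
  𝟙-no (yes p′) ¬p = ⊥-elim (¬p p′)
  𝟙-no (no _)   _  = refl

  𝟙≤1 : (P? : Dec P) → 𝟙 P? ≤ 1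
  𝟙≤1 (yes _) = s≤s z≤n
  𝟙≤1 (no _)  = z≤n

  𝟙≢0⇒holds : (P? : Dec P) → 𝟙 P? ≢ 0 → P
  𝟙≢0⇒holds (yes p′) _   = p′
  𝟙≢0⇒holds (no _)   ≢0 = ⊥-elim (≢0 refl)

  𝟙-idem : (P? : Dec P) → 𝟙 P? * 𝟙 P? ≡ 𝟙 P?
  𝟙-idem (yes _) = refl
  𝟙-idem (no _)  = refl

  𝟙-guard : (P? : Dec P) {L M : ℕ} → (P → L ≡ M) → 𝟙 P? * L ≡ 𝟙 P? * M
  𝟙-guard (yes p′) L≡M = cong (1 *_) (L≡M p′)
  𝟙-guard (no _)   _   = refl

  𝟙-absorb : (P? : Dec P) {x : ℕ} → (x ≢ 0 → P) → 𝟙 P? * x ≡ x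
  𝟙-absorb (yes _)  _               = +-identityʳ _
  𝟙-absorb (no _)   {zero}  _       = refl
  𝟙-absorb (no ¬p)  {suc x} forces  = ⊥-elim (¬p (forces λ ()))

𝟙-× : ∀ {p q} {P : Set p} {Q : Set q} (P? : Dec P) (Q? : Dec Q) → 𝟙 (P? ×-dec Q?) ≡ 𝟙 P? * 𝟙 Q?
𝟙-× (yes _) (yes _) = refl
𝟙-× (yes _) (no _)  = refl
𝟙-× (no _)  _       = refl

point-mass : ∀ {n} (f : Fin n → ℕ) → sum f ≡ 1 → ∀ j → f j ≡ 1 → ∀ i → i ≢ j → f i ≡ 0
point-mass f s j fj≡1 i i≢j = n≤0⇒n≡0 (+-cancelʳ-≤ 1 (f i) 0 fi+1≤1)
  where
  fi+1≤1 : f i + 1 ≤ 1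
  fi+1≤1 = subst₂ (λ a b → f i + a ≤ b) fj≡1 s (two-terms≤sum f i j i≢j)

point-mass-weight : ∀ {n} (f h : Fin n → ℕ) → sum f ≡ 1 → ∀ j → f j ≡ 1 →
                    ∑[ i < n ] (f i * h i) ≡ h j
point-mass-weight f h s j fj≡1 = begin
  ∑[ i < _ ] (f i * h i) ≡⟨ sum-single _ j (λ i i≢j → cong (_* h i) (point-mass f s j fj≡1 i i≢j)) ⟩
  f j * h j             ≡⟨ cong (_* h j) fj≡1 ⟩
  1 * h j               ≡⟨ *-identityˡ (h j) ⟩
  h j                   ∎
  where open ≡-Reasoning

length-filter : ∀ {a p} {A : Set a} {P : Pred A p} (P? : Decidable P) {n} (g : Fin n → A) →
                length (filter P? (tabulate g)) ≡ ∑[ i < n ] 𝟙 (P? (g i))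
length-filter P? {zero}  g = refl
length-filter P? {suc n} g with does (P? (g zero))
... | true  = cong suc (length-filter P? (g ∘ suc))
... | false = length-filter P? (g ∘ suc)

-- Multisets of naturals are lists up to permutation; they are determined by
-- the multiplicity occ v xs of each value v.
occ : ℕ → List ℕ → ℕ
occ v []       = 0
occ v (x ∷ xs) = 𝟙 (x ≟ v) + occ v xs

occ-++ : ∀ v xs ys → occ v (xs ++ ys) ≡ occ v xs + occ v ys
occ-++ v []       ys = refl
occ-++ v (x ∷ xs) ys = trans (cong (𝟙 (x ≟ v) +_) (occ-++ v xs ys)) (sym (+-assoc (𝟙 (x ≟ v)) _ _))

occ-self : ∀ x xs → occ x (x ∷ xs) ≡ suc (occ x xs)
occ-self x xs = cong (_+ occ x xs) (𝟙-yes (x ≟ x) refl)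

occ≢0⇒∈ : ∀ v xs → occ v xs ≢ 0 → v ∈ xs
occ≢0⇒∈ v []       occ≢0 = ⊥-elim (occ≢0 refl)
occ≢0⇒∈ v (x ∷ xs) occ≢0 with x ≟ v
... | yes x≡v = here (sym x≡v)
... | no  x≢v = there (occ≢0⇒∈ v xs (λ occ≡0 → occ≢0 (trans (cong (_+ occ v xs) (𝟙-no (x ≟ v) x≢v)) occ≡0)))

same-occ⇒↭ : ∀ xs ys → (∀ v → occ v xs ≡ occ v ys) → xs ↭ ys
same-occ⇒↭ []       []       _    = ↭-refl
same-occ⇒↭ []       (y ∷ ys) same = ⊥-elim (0≢1+n (trans (same y) (occ-self y ys)))
same-occ⇒↭ (x ∷ xs) ys       same
  with ∈-∃++ (occ≢0⇒∈ x ys (λ occ≡0 → 0≢1+n (trans (sym occ≡0) (trans (sym (same x)) (occ-self x xs)))))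
... | as , bs , refl = ↭-trans (prep x (same-occ⇒↭ xs (as ++ bs) same-rest)) (↭-sym (shift x as bs))
  where
  same-rest : ∀ v → occ v xs ≡ occ v (as ++ bs)
  same-rest v = +-cancelˡ-≡ (𝟙 (x ≟ v)) _ _ (begin
    𝟙 (x ≟ v) + occ v xs              ≡⟨ same v ⟩
    occ v (as ++ x ∷ bs)              ≡⟨ occ-++ v as (x ∷ bs) ⟩
    occ v as + (𝟙 (x ≟ v) + occ v bs) ≡⟨ x∙yz≈y∙xz (occ v as) (𝟙 (x ≟ v)) (occ v bs) ⟩
    𝟙 (x ≟ v) + (occ v as + occ v bs) ≡⟨ cong (𝟙 (x ≟ v) +_) (sym (occ-++ v as bs)) ⟩
    𝟙 (x ≟ v) + occ v (as ++ bs)      ∎)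
    where open ≡-Reasoning

occ-map-filter : ∀ {p} {n} {P : Pred (Fin n) p} (P? : Decidable P) (f : Fin n → ℕ) v →
                 occ v (map f (filter P? (allFin n))) ≡ ∑[ i < n ] (𝟙 (P? i) * 𝟙 (f i ≟ v))
occ-map-filter P? f v = go (λ i → i)
  where
  go : ∀ {k} (g : Fin k → Fin _) → occ v (map f (filter P? (tabulate g))) ≡ ∑[ i < k ] (𝟙 (P? (g i)) * 𝟙 (f (g i) ≟ v))
  go {zero}  g = refl
  go {suc k} g with does (P? (g zero))
  ... | true  = cong₂ _+_ (sym (+-identityʳ _)) (go (g ∘ suc))
  ... | false = go (g ∘ suc)

coprime-dichotomy : ∀ {t a c} c′ → Coprime t a → a * c ≡ t * c′ → c ≤ t → c ≡ 0 ⊎ c ≡ t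
coprime-dichotomy {c = zero}  _  _   _  _   = inj₁ refl
coprime-dichotomy {t} {c = suc _} c′ cop ac≡tc′ c≤t =
  inj₂ (≤-antisym c≤t (∣⇒≤ (coprime-divisor cop (divides c′ (trans ac≡tc′ (*-comm t c′))))))

module SchemeFacts {N K : ℕ} (C : Scheme N K) where
  open Scheme C

  χ : Fin K → Fin K → ℕ
  χ a b = 𝟙 (a ≟ᶠ b)

  χ-self : ∀ a → χ a a ≡ 1
  χ-self a = 𝟙-yes (a ≟ᶠ a) refl

  χ≤1 : ∀ a b → χ a b ≤ 1
  χ≤1 a b = 𝟙≤1 (a ≟ᶠ b)

  χ-pair≢0 : ∀ {a b A B} → χ a A * χ b B ≢ 0 → a ≡ A × b ≡ B
  χ-pair≢0 {a} {b} {A} {B} ≢0 =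
      𝟙≢0⇒holds (a ≟ᶠ A) (λ z → ≢0 (cong (_* χ b B) z))
    , 𝟙≢0⇒holds (b ≟ᶠ B) (λ z → ≢0 (trans (cong (χ a A *_) z) (*-zeroʳ (χ a A))))

  one-colour : ∀ a → ∑[ B < K ] χ a B ≡ 1
  one-colour a = trans (sum-single (χ a) a (λ B B≢a → 𝟙-no (a ≟ᶠ B) (B≢a ∘ sym))) (χ-self a)

  interNum-sum : ∀ A B u v → interNum col A B u v ≡ ∑[ w < N ] (χ (col u w) A * χ (col w v) B)
  interNum-sum A B u v =
    trans (length-filter (λ w → (col u w ≟ᶠ A) ×-dec (col w v ≟ᶠ B)) (λ w → w))
          (sum-cong-≗ (λ w → 𝟙-× (col u w ≟ᶠ A) (col w v ≟ᶠ B)))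

  interNum-transfer : ∀ A B {u v x z} → col u v ≡ col x z → interNum col A B u v ≡ interNum col A B x z
  interNum-transfer A B {u} {v} {x} {z} e = regular A B (col x z) u v x z e refl

  witness⇒interNum≢0 : ∀ {A B u v} w → col u w ≡ A → col w v ≡ B → interNum col A B u v ≢ 0
  witness⇒interNum≢0 {A} {B} {u} {v} w uw wv ≡0 =
    0≢1+n (sym (n≤0⇒n≡0 (subst₂ _≤_ term≡1 (trans (sym (interNum-sum A B u v)) ≡0)
                                 (term≤sum (λ w′ → χ (col u w′) A * χ (col w′ v) B) w))))
    where
    term≡1 : χ (col u w) A * χ (col w v) B ≡ 1
    term≡1 = cong₂ _*_ (trans (cong (λ a → χ a A) uw) (χ-self A)) (trans (cong (λ b → χ b B) wv) (χ-self B))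

  interNum≢0⇒witness : ∀ {A B u v} → interNum col A B u v ≢ 0 → ∃ λ w → col u w ≡ A × col w v ≡ B
  interNum≢0⇒witness {A} {B} {u} {v} ≢0
    with nonzero-term (λ w → χ (col u w) A * χ (col w v) B) (≢0 ∘ trans (interNum-sum A B u v))
  ... | w , term≢0 = w , χ-pair≢0 term≢0

  tr-involutive : ∀ a → tr (tr a) ≡ a
  tr-involutive a with surj a
  ... | (u , v) , uv≡a = begin
    tr (tr a)             ≡⟨ cong (tr ∘ tr) (sym uv≡a) ⟩
    tr (tr (col u v))     ≡⟨ cong tr (sym (transpose u v)) ⟩
    tr (col v u)          ≡⟨ sym (transpose v u) ⟩
    col u v               ≡⟨ uv≡a ⟩
    a                     ∎
    where open ≡-Reasoning

  tr-injective : ∀ {a b} → tr a ≡ tr b → a ≡ b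
  tr-injective {a} {b} e = trans (sym (tr-involutive a)) (trans (cong tr e) (tr-involutive b))

  χ-tr : ∀ a b → χ (tr a) (tr b) ≡ χ a b
  χ-tr a b with tr a ≟ᶠ tr b | a ≟ᶠ b
  ... | yes _   | yes _   = refl
  ... | no _    | no _    = refl
  ... | yes e   | no a≢b  = ⊥-elim (a≢b (tr-injective e))
  ... | no ¬e   | yes a≡b = ⊥-elim (¬e (cong tr a≡b))

  χ-transpose : ∀ u v A → χ (col v u) (tr A) ≡ χ (col u v) A
  χ-transpose u v A = trans (cong (λ k → χ k (tr A)) (transpose u v)) (χ-tr (col u v) A)

  outDeg : Fin N → Fin K → ℕ
  outDeg u A = ∑[ v < N ] χ (col u v) A

  size : Fin K → ℕ
  size A = ∑[ u < N ] outDeg u A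

  inDeg≡outDeg : ∀ v A → ∑[ u < N ] χ (col u v) A ≡ outDeg v (tr A)
  inDeg≡outDeg v A = sum-cong-≗ (λ u → sym (χ-transpose u v A))

  size-tr : ∀ A → size (tr A) ≡ size A
  size-tr A = trans (sum-cong-≗ (λ u → sum-cong-≗ (λ v → χ-transpose v u A))) (∑-comm (λ u v → χ (col v u) A))

  outDeg≡interNum : ∀ u A → outDeg u A ≡ interNum col A (tr A) u u
  outDeg≡interNum u A = trans (sum-cong-≗ χ≡χ²) (sym (interNum-sum A (tr A) u u))
    where
    χ≡χ² : ∀ w → χ (col u w) A ≡ χ (col u w) A * χ (col w u) (tr A)
    χ≡χ² w = sym (trans (cong (χ (col u w) A *_) (χ-transpose u w A)) (𝟙-idem (col u w ≟ᶠ A)))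

  outDeg-fiber-invariant : ∀ {u u′} A → col u u ≡ col u′ u′ → outDeg u A ≡ outDeg u′ A
  outDeg-fiber-invariant {u} {u′} A e =
    trans (outDeg≡interNum u A) (trans (interNum-transfer A (tr A) e) (sym (outDeg≡interNum u′ A)))

  source-fiber : ∀ {u v x z} → col u v ≡ col x z → col u u ≡ col x x
  source-fiber {u} {v} {x} {z} e
    with interNum≢0⇒witness (witness⇒interNum≢0 x refl refl ∘ trans (sym (interNum-transfer (col x x) (col x z) e)))
  ... | w , uw≡xx , _ = subst (λ q → col u q ≡ col x x) (sym (diag u w x uw≡xx)) uw≡xx

  target-fiber : ∀ {u v x z} → col u v ≡ col x z → col v v ≡ col z z
  target-fiber {u} {v} {x} {z} e
    with interNum≢0⇒witness (witness⇒interNum≢0 z refl refl ∘ trans (sym (interNum-transfer (col x z) (col z z) e)))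
  ... | w , _ , wv≡zz = subst (λ q → col q v ≡ col z z) (diag w v z wv≡zz) wv≡zz

  InRel-of-pair : ∀ {X Z S x z} → col x z ≡ S → col x x ≡ X → col z z ≡ Z → InRel C X Z S
  InRel-of-pair xz≡S xx≡X zz≡Z u v uv≡S =
      trans (source-fiber (trans uv≡S (sym xz≡S))) xx≡X
    , trans (target-fiber (trans uv≡S (sym xz≡S))) zz≡Z

  InRel-tr : ∀ {X Y A} → InRel C X Y A → InRel C Y X (tr A)
  InRel-tr h u v uv≡A* with h v u (tr-injective (trans (sym (transpose v u)) uv≡A*))
  ... | vv≡X , uu≡Y = uu≡Y , vv≡X

  src tgt : Fin K → Fin N
  src A = proj₁ (proj₁ (surj A))
  tgt A = proj₂ (proj₁ (surj A))

  src-tgt : ∀ A → col (src A) (tgt A) ≡ A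
  src-tgt A = proj₂ (surj A)

  src-fiber : ∀ {X Y A} → InRel C X Y A → col (src A) (src A) ≡ X
  src-fiber {A = A} h = proj₁ (h _ _ (src-tgt A))

  tgt-fiber : ∀ {X Y A} → InRel C X Y A → col (tgt A) (tgt A) ≡ Y
  tgt-fiber {A = A} h = proj₂ (h _ _ (src-tgt A))

  d≡outDeg : ∀ A → d C A ≡ outDeg (src A) A
  d≡outDeg A = length-filter (λ y → col (src A) y ≟ᶠ A) (λ y → y)

  d-pos : ∀ A → 1 ≤ d C A
  d-pos A = subst₂ _≤_ (trans (cong (λ k → χ k A) (src-tgt A)) (χ-self A)) (sym (d≡outDeg A))
                   (term≤sum (λ v → χ (col (src A) v) A) (tgt A))

  outDeg-source : ∀ {X Y A u} → InRel C X Y A → col u u ≡ X → outDeg u A ≡ d C A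
  outDeg-source {A = A} h uu≡X =
    trans (outDeg-fiber-invariant A (trans uu≡X (sym (src-fiber h)))) (sym (d≡outDeg A))

  outDeg-InRel : ∀ {X Y A} → InRel C X Y A → ∀ u → outDeg u A ≡ χ (col u u) X * d C A
  outDeg-InRel {X} h u with col u u ≟ᶠ X
  ... | yes uu≡X = trans (outDeg-source h uu≡X) (sym (+-identityʳ _))
  ... | no  uu≢X = sum-zero (λ v → 𝟙-no (_ ≟ᶠ _) (uu≢X ∘ proj₁ ∘ h u v))

  fiberSize≡sum : ∀ X → fiberSize C X ≡ ∑[ u < N ] χ (col u u) X
  fiberSize≡sum X = length-filter (λ x → col x x ≟ᶠ X) (λ x → x)

  fiberSize-pos : ∀ {X} x → col x x ≡ X → 1 ≤ fiberSize C X
  fiberSize-pos {X} x xx≡X = subst₂ _≤_ (trans (cong (λ k → χ k X) xx≡X) (χ-self X)) (sym (fiberSize≡sum X))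
                                     (term≤sum (λ u → χ (col u u) X) x)

  size-InRel : ∀ {X Y A} → InRel C X Y A → size A ≡ fiberSize C X * d C A
  size-InRel {X} {A = A} h = begin
    size A                                  ≡⟨ sum-cong-≗ (outDeg-InRel h) ⟩
    ∑[ u < N ] (χ (col u u) X * d C A)      ≡⟨ sym (*-distribʳ-sum (d C A) (λ u → χ (col u u) X)) ⟩
    (∑[ u < N ] χ (col u u) X) * d C A      ≡⟨ cong (_* d C A) (sym (fiberSize≡sum X)) ⟩
    fiberSize C X * d C A                   ∎
    where open ≡-Reasoning

  d-tr : ∀ {X Y A} → InRel C X Y A → fiberSize C X ≡ fiberSize C Y → d C (tr A) ≡ d C A
  d-tr {X} {Y} {A} h |X|≡|Y| = *-cancelˡ-≡ _ _ (fiberSize C X) {{>-nonZero (fiberSize-pos (src A) (src-fiber h))}} (begin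
    fiberSize C X * d C (tr A)   ≡⟨ cong (_* d C (tr A)) |X|≡|Y| ⟩
    fiberSize C Y * d C (tr A)   ≡⟨ sym (size-InRel (InRel-tr h)) ⟩
    size (tr A)                  ≡⟨ size-tr A ⟩
    size A                       ≡⟨ size-InRel h ⟩
    fiberSize C X * d C A        ∎)
    where open ≡-Reasoning

  p : Fin K → Fin K → Fin K → ℕ
  p A B Q = interNum col A B (src Q) (tgt Q)

  interNum≡p : ∀ A B {Q u v} → col u v ≡ Q → interNum col A B u v ≡ p A B Q
  interNum≡p A B {Q} uv≡Q = interNum-transfer A B (trans uv≡Q (sym (src-tgt Q)))

  interNum≤outDeg : ∀ A B u v → interNum col A B u v ≤ outDeg u A
  interNum≤outDeg A B u v = subst (_≤ outDeg u A) (sym (interNum-sum A B u v))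
    (sum-mono (λ w → ≤-trans (*-monoʳ-≤ (χ (col u w) A) (χ≤1 (col w v) B)) (≤-reflexive (*-identityʳ _))))

  interNum≤inDeg : ∀ A B u v → interNum col A B u v ≤ outDeg v (tr B)
  interNum≤inDeg A B u v = subst₂ _≤_ (sym (interNum-sum A B u v)) (inDeg≡outDeg v B)
    (sum-mono (λ w → ≤-trans (*-monoˡ-≤ (χ (col w v) B) (χ≤1 (col u w) A)) (≤-reflexive (*-identityˡ _))))

  interNum-sum-colours : ∀ A u v (g : Fin K → Fin K) → (∀ c → ∑[ R < K ] χ c (g R) ≡ 1) →
                         ∑[ R < K ] interNum col A (g R) u v ≡ outDeg u A
  interNum-sum-colours A u v g once = begin
    ∑[ R < K ] interNum col A (g R) u v                            ≡⟨ sum-cong-≗ (λ R → interNum-sum A (g R) u v) ⟩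
    ∑[ R < K ] ∑[ w < N ] (χ (col u w) A * χ (col w v) (g R))      ≡⟨ ∑-comm (λ R w → χ (col u w) A * χ (col w v) (g R)) ⟩
    ∑[ w < N ] ∑[ R < K ] (χ (col u w) A * χ (col w v) (g R))      ≡⟨ sum-cong-≗ (λ w → sym (*-distribˡ-sum (χ (col u w) A) (λ R → χ (col w v) (g R)))) ⟩
    ∑[ w < N ] (χ (col u w) A * ∑[ R < K ] χ (col w v) (g R))      ≡⟨ sum-cong-≗ (λ w → cong (χ (col u w) A *_) (once (col w v))) ⟩
    ∑[ w < N ] (χ (col u w) A * 1)                                 ≡⟨ sum-cong-≗ (λ w → *-identityʳ (χ (col u w) A)) ⟩
    outDeg u A                                                     ∎
    where open ≡-Reasoning

  one-colour-tr : ∀ c → ∑[ R < K ] χ c (tr R) ≡ 1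
  one-colour-tr c = trans (sum-cong-≗ (λ R → trans (cong (λ a → χ a (tr R)) (sym (tr-involutive c))) (χ-tr (tr c) R)))
                          (one-colour (tr c))

  weighted-size : ∀ Q (G : Fin N → Fin N → ℕ) c → (∀ u v → col u v ≡ Q → G u v ≡ c) →
                  ∑[ u < N ] ∑[ v < N ] (χ (col u v) Q * G u v) ≡ c * size Q
  weighted-size Q G c G≡c = begin
    ∑[ u < N ] ∑[ v < N ] (χ (col u v) Q * G u v) ≡⟨ sum-cong-≗ (λ u → sum-cong-≗ (termwise u)) ⟩
    ∑[ u < N ] ∑[ v < N ] (c * χ (col u v) Q)     ≡⟨ sum-cong-≗ (λ u → sym (*-distribˡ-sum c (λ v → χ (col u v) Q))) ⟩
    ∑[ u < N ] (c * outDeg u Q)                   ≡⟨ sym (*-distribˡ-sum c (λ u → outDeg u Q)) ⟩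
    c * size Q                                    ∎
    where
    open ≡-Reasoning
    termwise : ∀ u v → χ (col u v) Q * G u v ≡ c * χ (col u v) Q
    termwise u v with col u v ≟ᶠ Q
    ... | yes uv≡Q = trans (+-identityʳ _) (trans (G≡c u v uv≡Q) (sym (*-identityʳ c)))
    ... | no  _    = sym (*-zeroʳ c)

  interNum-weighted : ∀ A B Q → ∑[ u < N ] ∑[ v < N ] (χ (col u v) Q * interNum col A B u v) ≡ p A B Q * size Q
  interNum-weighted A B Q = weighted-size Q (interNum col A B) (p A B Q) (λ u v → interNum≡p A B)

  triangle : Fin K → Fin K → Fin K → Fin N → Fin N → Fin N → ℕ
  triangle T R S x w z = χ (col x w) T * χ (col w z) R * χ (col x z) S

  triangles : Fin K → Fin K → Fin K → ℕ
  triangles T R S = ∑[ x < N ] ∑[ w < N ] ∑[ z < N ] triangle T R S x w z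

  triangles-via-S : ∀ T R S → triangles T R S ≡ p T R S * size S
  triangles-via-S T R S = begin
    triangles T R S                                        ≡⟨ sum-cong-≗ (λ x → ∑-comm (triangle T R S x)) ⟩
    ∑[ x < N ] ∑[ z < N ] ∑[ w < N ] triangle T R S x w z   ≡⟨ sum-cong-≗ (λ x → sum-cong-≗ (through x)) ⟩
    ∑[ x < N ] ∑[ z < N ] (χ (col x z) S * interNum col T R x z) ≡⟨ interNum-weighted T R S ⟩
    p T R S * size S                                       ∎
    where
    open ≡-Reasoning
    through : ∀ x z → ∑[ w < N ] triangle T R S x w z ≡ χ (col x z) S * interNum col T R x z
    through x z = begin
      ∑[ w < N ] triangle T R S x w z                          ≡⟨ sum-cong-≗ (λ w → *-Comm.xy∙z≈z∙xy (χ (col x w) T) _ _) ⟩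
      ∑[ w < N ] (χ (col x z) S * (χ (col x w) T * χ (col w z) R)) ≡⟨ sym (*-distribˡ-sum (χ (col x z) S) (λ w → χ (col x w) T * χ (col w z) R)) ⟩
      χ (col x z) S * ∑[ w < N ] (χ (col x w) T * χ (col w z) R)   ≡⟨ cong (χ (col x z) S *_) (sym (interNum-sum T R x z)) ⟩
      χ (col x z) S * interNum col T R x z                          ∎

  triangles-via-T : ∀ T R S → triangles T R S ≡ p S (tr R) T * size T
  triangles-via-T T R S = begin
    triangles T R S                                        ≡⟨ sum-cong-≗ (λ x → sum-cong-≗ (through x)) ⟩
    ∑[ x < N ] ∑[ w < N ] (χ (col x w) T * interNum col S (tr R) x w) ≡⟨ interNum-weighted S (tr R) T ⟩
    p S (tr R) T * size T                                  ∎
    where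
    open ≡-Reasoning
    through : ∀ x w → ∑[ z < N ] triangle T R S x w z ≡ χ (col x w) T * interNum col S (tr R) x w
    through x w = begin
      ∑[ z < N ] triangle T R S x w z                                   ≡⟨ sum-cong-≗ termwise ⟩
      ∑[ z < N ] (χ (col x w) T * (χ (col x z) S * χ (col z w) (tr R)))  ≡⟨ sym (*-distribˡ-sum (χ (col x w) T) (λ z → χ (col x z) S * χ (col z w) (tr R))) ⟩
      χ (col x w) T * ∑[ z < N ] (χ (col x z) S * χ (col z w) (tr R))    ≡⟨ cong (χ (col x w) T *_) (sym (interNum-sum S (tr R) x w)) ⟩
      χ (col x w) T * interNum col S (tr R) x w                          ∎
      where
      termwise : ∀ z → triangle T R S x w z ≡ χ (col x w) T * (χ (col x z) S * χ (col z w) (tr R))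
      termwise z = trans (*-Comm.xy∙z≈x∙zy (χ (col x w) T) _ _)
                         (cong (λ b → χ (col x w) T * (χ (col x z) S * b)) (sym (χ-transpose w z R)))

  triangles-via-R : ∀ T R S → triangles T R S ≡ p (tr T) S R * size R
  triangles-via-R T R S = begin
    triangles T R S                                        ≡⟨ ∑-comm (λ x w → ∑[ z < N ] triangle T R S x w z) ⟩
    ∑[ w < N ] ∑[ x < N ] ∑[ z < N ] triangle T R S x w z   ≡⟨ sum-cong-≗ (λ w → ∑-comm (λ x z → triangle T R S x w z)) ⟩
    ∑[ w < N ] ∑[ z < N ] ∑[ x < N ] triangle T R S x w z   ≡⟨ sum-cong-≗ (λ w → sum-cong-≗ (through w)) ⟩
    ∑[ w < N ] ∑[ z < N ] (χ (col w z) R * interNum col (tr T) S w z) ≡⟨ interNum-weighted (tr T) S R ⟩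
    p (tr T) S R * size R                                  ∎
    where
    open ≡-Reasoning
    through : ∀ w z → ∑[ x < N ] triangle T R S x w z ≡ χ (col w z) R * interNum col (tr T) S w z
    through w z = begin
      ∑[ x < N ] triangle T R S x w z                                   ≡⟨ sum-cong-≗ termwise ⟩
      ∑[ x < N ] (χ (col w z) R * (χ (col w x) (tr T) * χ (col x z) S))  ≡⟨ sym (*-distribˡ-sum (χ (col w z) R) (λ x → χ (col w x) (tr T) * χ (col x z) S)) ⟩
      χ (col w z) R * ∑[ x < N ] (χ (col w x) (tr T) * χ (col x z) S)    ≡⟨ cong (χ (col w z) R *_) (sym (interNum-sum (tr T) S w z)) ⟩
      χ (col w z) R * interNum col (tr T) S w z                          ∎
      where
      termwise : ∀ x → triangle T R S x w z ≡ χ (col w z) R * (χ (col w x) (tr T) * χ (col x z) S)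
      termwise x = trans (*-Comm.xy∙z≈y∙xz (χ (col x w) T) _ _)
                         (cong (λ a → χ (col w z) R * (a * χ (col x z) S)) (sym (χ-transpose x w T)))

  ∈rels⇒InRel : ∀ {A B R} → R ∈ rels C A B → InRel C A B R
  ∈rels⇒InRel {A} {B} R∈ = proj₂ (∈-filter⁻ (inRel? C A B) {xs = allFin K} R∈)

  InRel⇒∈rels : ∀ {A B R} → InRel C A B R → R ∈ rels C A B
  InRel⇒∈rels {A} {B} {R} h = ∈-filter⁺ (inRel? C A B) (∈-allFin R) h

  length-rels : ∀ A B → length (rels C A B) ≡ ∑[ R < K ] 𝟙 (inRel? C A B R)
  length-rels A B = length-filter (inRel? C A B) (λ R → R)

module Lemma14Proof {N K : ℕ} (C : Scheme N K) {m n r : ℕ} (mnr : IsMNR C m n r)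
  {X Y Z : Fin K} (fX : IsFiber C X) (fY : IsFiber C Y) (fZ : IsFiber C Z)
  {T : Fin K} (T∈ : T ∈ rels C X Y) (cop : Coprime (d C T) (product (dMulti C Y Z))) where
  open Scheme C
  open SchemeFacts C
  open IsMNR mnr

  t : ℕ
  t = d C T

  T⊆X×Y : InRel C X Y T
  T⊆X×Y = ∈rels⇒InRel T∈

  |X|≡m : fiberSize C X ≡ m
  |X|≡m = fiberCard X fX

  |Y|≡m : fiberSize C Y ≡ m
  |Y|≡m = fiberCard Y fY

  instance
    t≢0 : NonZero t
    t≢0 = >-nonZero (d-pos T)

    m≢0 : NonZero m
    m≢0 = >-nonZero (subst (1 ≤_) |X|≡m (fiberSize-pos (src T) (src-fiber T⊆X×Y)))

  -- |A| = m d_A, in the scaled form the triangle identities need.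
  scaled-size : ∀ {U V A} → fiberSize C U ≡ m → InRel C U V A → ∀ c → c * size A ≡ m * (d C A * c)
  scaled-size {A = A} |U|≡m h c =
    trans (cong (c *_) (trans (size-InRel h) (cong (_* d C A) |U|≡m))) (sym (*-Comm.x∙yz≈z∙xy m (d C A) c))

  -- For R ∈ ℛ_{Y,Z} and a colour S, with (w , z) ∈ R, (x , w′) ∈ T, (x′ , z′) ∈ S:
  --   c₁ R S = #{x : x →T w, (x , z) ∈ S},  c₂ R S = #{z : (x , z) ∈ S, w′ →R z},
  --   c₃ R S = #{w : x′ →T w →R z′}.
  c₁ c₂ c₃ : Fin K → Fin K → ℕ
  c₁ R S = p (tr T) S R
  c₂ R S = p S (tr R) T
  c₃ R S = p T R S

  dR·c₁≡t·c₂ : ∀ {R} S → InRel C Y Z R → d C R * c₁ R S ≡ t * c₂ R S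
  dR·c₁≡t·c₂ {R} S hR = *-cancelˡ-≡ _ _ m (begin
    m * (d C R * c₁ R S) ≡⟨ sym (scaled-size |Y|≡m hR (c₁ R S)) ⟩
    c₁ R S * size R      ≡⟨ sym (triangles-via-R T R S) ⟩
    triangles T R S      ≡⟨ triangles-via-T T R S ⟩
    c₂ R S * size T      ≡⟨ scaled-size |X|≡m T⊆X×Y (c₂ R S) ⟩
    m * (t * c₂ R S)     ∎)
    where open ≡-Reasoning

  dR·c₁≡dS·c₃ : ∀ {R S} → InRel C Y Z R → InRel C X Z S → d C R * c₁ R S ≡ d C S * c₃ R S
  dR·c₁≡dS·c₃ {R} {S} hR hS = *-cancelˡ-≡ _ _ m (begin
    m * (d C R * c₁ R S) ≡⟨ sym (scaled-size |Y|≡m hR (c₁ R S)) ⟩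
    c₁ R S * size R      ≡⟨ sym (triangles-via-R T R S) ⟩
    triangles T R S      ≡⟨ triangles-via-S T R S ⟩
    c₃ R S * size S      ≡⟨ scaled-size |X|≡m hS (c₃ R S) ⟩
    m * (d C S * c₃ R S) ∎)
    where open ≡-Reasoning

  inDeg-T : ∀ {w} → col w w ≡ Y → outDeg w (tr T) ≡ t
  inDeg-T ww≡Y = trans (outDeg-source (InRel-tr T⊆X×Y) ww≡Y) (d-tr T⊆X×Y (trans |X|≡m (sym |Y|≡m)))

  c₁≤t : ∀ {R} S → InRel C Y Z R → c₁ R S ≤ t
  c₁≤t {R} S hR = subst (c₁ R S ≤_) (inDeg-T (src-fiber hR)) (interNum≤outDeg (tr T) S (src R) (tgt R))

  sum-c₁ : ∀ {R} → InRel C Y Z R → ∑[ S < K ] c₁ R S ≡ t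
  sum-c₁ {R} hR = trans (interNum-sum-colours (tr T) (src R) (tgt R) (λ S → S) one-colour) (inDeg-T (src-fiber hR))

  coprime-R : ∀ {R} → InRel C Y Z R → Coprime t (d C R)
  coprime-R hR (i∣t , i∣dR) = cop (i∣t , ∣-trans i∣dR (∈⇒∣product (∈-map⁺ (d C) (InRel⇒∈rels hR))))

  -- S is the partner of R when (x , z) ∈ S for every T-predecessor x of w,
  -- i.e. when c₁ R S = t.
  partner : Fin K → Fin K → ℕ
  partner R S = 𝟙 (c₁ R S ≟ t)

  c₁≡partner·t : ∀ {R} S → InRel C Y Z R → c₁ R S ≡ partner R S * t
  c₁≡partner·t {R} S hR with coprime-dichotomy (c₂ R S) (coprime-R hR) (dR·c₁≡t·c₂ S hR) (c₁≤t S hR)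
  ... | inj₁ c₁≡0 = trans c₁≡0 (sym (cong (_* t) (𝟙-no (c₁ R S ≟ t) (λ c₁≡t → ≢-nonZero⁻¹ t (trans (sym c₁≡t) c₁≡0)))))
  ... | inj₂ c₁≡t = trans c₁≡t (sym (trans (cong (_* t) (𝟙-yes (c₁ R S ≟ t) c₁≡t)) (*-identityˡ t)))

  partners-sum : ∀ {R} → InRel C Y Z R → ∑[ S < K ] partner R S ≡ 1
  partners-sum {R} hR = *-cancelʳ-≡ _ _ t (begin
    (∑[ S < K ] partner R S) * t  ≡⟨ *-distribʳ-sum t (partner R) ⟩
    ∑[ S < K ] (partner R S * t)  ≡⟨ sum-cong-≗ (λ S → sym (c₁≡partner·t S hR)) ⟩
    ∑[ S < K ] c₁ R S             ≡⟨ sum-c₁ hR ⟩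
    t                             ≡⟨ sym (*-identityˡ t) ⟩
    1 * t                         ∎)
    where open ≡-Reasoning

  partner⊆X×Z : ∀ {R S} → InRel C Y Z R → partner R S ≢ 0 → InRel C X Z S
  partner⊆X×Z {R} {S} hR partner≢0
    with interNum≢0⇒witness {tr T} {S} {src R} {tgt R}
           (λ c₁≡0 → ≢-nonZero⁻¹ t (trans (sym (𝟙≢0⇒holds (c₁ R S ≟ t) partner≢0)) c₁≡0))
  ... | x , wx≡T* , xz≡S = InRel-of-pair xz≡S (proj₁ (T⊆X×Y x (src R) xw≡T)) (tgt-fiber hR)
    where
    xw≡T : col x (src R) ≡ T
    xw≡T = tr-injective (trans (sym (transpose x (src R))) wx≡T*)

  a b : Fin K → ℕ
  a R = 𝟙 (inRel? C Y Z R)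
  b S = 𝟙 (inRel? C X Z S)

  M : Fin K → Fin K → ℕ
  M R S = a R * partner R S

  M≢0⇒S⊆X×Z : ∀ {R S} → M R S ≢ 0 → InRel C X Z S
  M≢0⇒S⊆X×Z {R} {S} M≢0 =
    partner⊆X×Z (𝟙≢0⇒holds (inRel? C Y Z R) (λ aR≡0 → M≢0 (cong (_* partner R S) aR≡0)))
                (λ partner≡0 → M≢0 (trans (cong (a R *_) partner≡0) (*-zeroʳ (a R))))

  M≤1 : ∀ R S → M R S ≤ 1
  M≤1 R S = ≤-trans (*-monoˡ-≤ (partner R S) (𝟙≤1 (inRel? C Y Z R)))
                    (≤-trans (≤-reflexive (*-identityˡ (partner R S))) (𝟙≤1 (c₁ R S ≟ t)))

  row-sum : ∀ R → ∑[ S < K ] (b S * M R S) ≡ a R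
  row-sum R = begin
    ∑[ S < K ] (b S * M R S)        ≡⟨ sum-cong-≗ (λ S → 𝟙-absorb (inRel? C X Z S) M≢0⇒S⊆X×Z) ⟩
    ∑[ S < K ] (a R * partner R S)  ≡⟨ sym (*-distribˡ-sum (a R) (partner R)) ⟩
    a R * ∑[ S < K ] partner R S    ≡⟨ 𝟙-guard (inRel? C Y Z R) partners-sum ⟩
    a R * 1                         ≡⟨ *-identityʳ (a R) ⟩
    a R                             ∎
    where open ≡-Reasoning

  -- c₂ R S = M R S · d_R: by the triangle identity inside ℛ_{Y,Z}, and because
  -- outside ℛ_{Y,Z} no path x →S z ←R w′ can exist.
  c₂-inside : ∀ {R S} → InRel C Y Z R → c₂ R S ≡ partner R S * d C R
  c₂-inside {R} {S} hR = *-cancelˡ-≡ _ _ t (begin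
    t * c₂ R S                  ≡⟨ sym (dR·c₁≡t·c₂ S hR) ⟩
    d C R * c₁ R S              ≡⟨ cong (d C R *_) (c₁≡partner·t S hR) ⟩
    d C R * (partner R S * t)   ≡⟨ *-Comm.x∙yz≈z∙yx (d C R) (partner R S) t ⟩
    t * (partner R S * d C R)   ∎)
    where open ≡-Reasoning

  c₂-outside : ∀ {R S} → ¬ InRel C Y Z R → InRel C X Z S → c₂ R S ≡ 0
  c₂-outside {R} {S} R⊈Y×Z hS with c₂ R S ≟ 0
  ... | yes c₂≡0 = c₂≡0
  ... | no  c₂≢0 with interNum≢0⇒witness {S} {tr R} {src T} {tgt T} c₂≢0
  ...   | z , xz≡S , zw≡R* = ⊥-elim (R⊈Y×Z (InRel-of-pair wz≡R (tgt-fiber T⊆X×Y) (proj₂ (hS (src T) z xz≡S))))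
    where
    wz≡R : col (tgt T) z ≡ R
    wz≡R = tr-injective (trans (sym (transpose (tgt T) z)) zw≡R*)

  c₂≡M·d : ∀ {R S} → InRel C X Z S → c₂ R S ≡ M R S * d C R
  c₂≡M·d {R} {S} hS = by-cases (inRel? C Y Z R)
    where
    by-cases : (R? : Dec (InRel C Y Z R)) → c₂ R S ≡ 𝟙 R? * partner R S * d C R
    by-cases (yes hR)    = trans (c₂-inside hR) (cong (_* d C R) (sym (*-identityˡ (partner R S))))
    by-cases (no R⊈Y×Z) = c₂-outside R⊈Y×Z hS

  d-decomposition : ∀ {S} → InRel C X Z S → d C S ≡ ∑[ R < K ] (M R S * d C R)
  d-decomposition {S} hS = begin
    d C S                              ≡⟨ sym (outDeg-source hS (src-fiber T⊆X×Y)) ⟩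
    outDeg (src T) S                   ≡⟨ sym (interNum-sum-colours S (src T) (tgt T) tr one-colour-tr) ⟩
    ∑[ R < K ] c₂ R S                  ≡⟨ sum-cong-≗ (λ R → c₂≡M·d {R} hS) ⟩
    ∑[ R < K ] (M R S * d C R)         ∎
    where open ≡-Reasoning

  colSum : Fin K → ℕ
  colSum S = ∑[ R < K ] M R S

  colSum-pos : ∀ {S} → InRel C X Z S → 1 ≤ colSum S
  colSum-pos {S} hS = n≢0⇒n>0 λ colSum≡0 → ≢-nonZero⁻¹ (d C S) {{>-nonZero (d-pos S)}}
    (trans (d-decomposition hS) (sum-zero (λ R → cong (_* d C R) (sum≡0⇒term≡0 (λ R → M R S) colSum≡0 R))))

  -- Both index sets have r elements, so the column sums over ℛ_{X,Z} add up to |ℛ_{X,Z}|.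
  weighted-colSums : ∑[ S < K ] (b S * colSum S) ≡ ∑[ S < K ] b S
  weighted-colSums = begin
    ∑[ S < K ] (b S * colSum S)            ≡⟨ sum-cong-≗ (λ S → *-distribˡ-sum (b S) (λ R → M R S)) ⟩
    ∑[ S < K ] ∑[ R < K ] (b S * M R S)    ≡⟨ ∑-comm (λ S R → b S * M R S) ⟩
    ∑[ R < K ] ∑[ S < K ] (b S * M R S)    ≡⟨ sum-cong-≗ row-sum ⟩
    ∑[ R < K ] a R                         ≡⟨ sym (length-rels Y Z) ⟩
    length (rels C Y Z)                    ≡⟨ trans (relCount Y Z fY fZ) (sym (relCount X Z fX fZ)) ⟩
    length (rels C X Z)                    ≡⟨ length-rels X Z ⟩
    ∑[ S < K ] b S                         ∎
    where open ≡-Reasoning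

  colSum-one : ∀ {S} → InRel C X Z S → colSum S ≡ 1
  colSum-one {S} hS = begin
    colSum S          ≡⟨ sym (*-identityˡ (colSum S)) ⟩
    1 * colSum S      ≡⟨ cong (_* colSum S) (sym bS≡1) ⟩
    b S * colSum S    ≡⟨ sym bS≡bS·colSum ⟩
    b S               ≡⟨ bS≡1 ⟩
    1                 ∎
    where
    open ≡-Reasoning
    bS≡1 : b S ≡ 1
    bS≡1 = 𝟙-yes (inRel? C X Z S) hS
    b≤b·colSum : ∀ S → b S ≤ b S * colSum S
    b≤b·colSum S = by-cases (inRel? C X Z S)
      where
      by-cases : (S? : Dec (InRel C X Z S)) → 𝟙 S? ≤ 𝟙 S? * colSum S
      by-cases (yes hS′) = ≤-trans (colSum-pos hS′) (≤-reflexive (sym (*-identityˡ (colSum S))))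
      by-cases (no _)    = z≤n
    bS≡bS·colSum : b S ≡ b S * colSum S
    bS≡bS·colSum = sum-mono-≡ b≤b·colSum (sym weighted-colSums) S

  partner-of : ∀ {S} → InRel C X Z S → ∃ λ R → M R S ≡ 1
  partner-of {S} hS = one-of (nonzero-term (λ R → M R S) (λ colSum≡0 → 0≢1+n (trans (sym colSum≡0) (colSum-one hS))))
    where
    one-of : (∃ λ R → M R S ≢ 0) → ∃ λ R → M R S ≡ 1
    one-of (R , M≢0) = R , ≤-antisym (M≤1 R S) (n≢0⇒n>0 M≢0)

  column-weight : ∀ {R S} → InRel C X Z S → M R S ≡ 1 → ∀ h → ∑[ R′ < K ] (M R′ S * h R′) ≡ h R
  column-weight {R} {S} hS M≡1 h = point-mass-weight (λ R′ → M R′ S) h (colSum-one hS) R M≡1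

  d-partner : ∀ {R S} → InRel C X Z S → M R S ≡ 1 → d C S ≡ d C R
  d-partner hS M≡1 = trans (d-decomposition hS) (column-weight hS M≡1 (d C))

  same-multiplicities : ∀ v → occ v (dMulti C Y Z) ≡ occ v (dMulti C X Z)
  same-multiplicities v = begin
    occ v (dMulti C Y Z)                                   ≡⟨ occ-map-filter (inRel? C Y Z) (d C) v ⟩
    ∑[ R < K ] (a R * ⟦ R ⟧)                               ≡⟨ sum-cong-≗ (λ R → cong (_* ⟦ R ⟧) (sym (row-sum R))) ⟩
    ∑[ R < K ] (∑[ S < K ] (b S * M R S) * ⟦ R ⟧)          ≡⟨ sum-cong-≗ (λ R → *-distribʳ-sum ⟦ R ⟧ (λ S → b S * M R S)) ⟩
    ∑[ R < K ] ∑[ S < K ] (b S * M R S * ⟦ R ⟧)            ≡⟨ ∑-comm (λ R S → b S * M R S * ⟦ R ⟧) ⟩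
    ∑[ S < K ] ∑[ R < K ] (b S * M R S * ⟦ R ⟧)            ≡⟨ sum-cong-≗ (λ S → sum-cong-≗ (λ R → *-assoc (b S) (M R S) ⟦ R ⟧)) ⟩
    ∑[ S < K ] ∑[ R < K ] (b S * (M R S * ⟦ R ⟧))          ≡⟨ sum-cong-≗ (λ S → sym (*-distribˡ-sum (b S) (λ R → M R S * ⟦ R ⟧))) ⟩
    ∑[ S < K ] (b S * ∑[ R < K ] (M R S * ⟦ R ⟧))          ≡⟨ sum-cong-≗ (λ S → 𝟙-guard (inRel? C X Z S) pick) ⟩
    ∑[ S < K ] (b S * ⟦ S ⟧)                               ≡⟨ sym (occ-map-filter (inRel? C X Z) (d C) v) ⟩
    occ v (dMulti C X Z)                                   ∎
    where
    open ≡-Reasoning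
    ⟦_⟧ : Fin K → ℕ
    ⟦ A ⟧ = 𝟙 (d C A ≟ v)
    pick : ∀ {S} → InRel C X Z S → ∑[ R < K ] (M R S * ⟦ R ⟧) ≡ ⟦ S ⟧
    pick {S} hS = via (partner-of hS)
      where
      via : (∃ λ R → M R S ≡ 1) → ∑[ R < K ] (M R S * ⟦ R ⟧) ≡ ⟦ S ⟧
      via (R , M≡1) = trans (column-weight hS M≡1 ⟦_⟧) (cong (λ k → 𝟙 (k ≟ v)) (sym (d-partner hS M≡1)))

  -- t ≤ d_R: for a partner S of R, t d_R = d_S c₃ = d_R c₃, and c₃ is at most
  -- the in-valency d_{R*} = d_R.
  partner-bound : ∀ {R S} → InRel C Y Z R → partner R S ≢ 0 → t ≤ d C R
  partner-bound {R} {S} hR partner≢0 = subst (_≤ d C R) (sym t≡c₃) c₃≤dR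
    where
    hS : InRel C X Z S
    hS = partner⊆X×Z hR partner≢0
    c₁≡t : c₁ R S ≡ t
    c₁≡t = 𝟙≢0⇒holds (c₁ R S ≟ t) partner≢0
    M≡1 : M R S ≡ 1
    M≡1 = cong₂ _*_ (𝟙-yes (inRel? C Y Z R) hR) (𝟙-yes (c₁ R S ≟ t) c₁≡t)
    t≡c₃ : t ≡ c₃ R S
    t≡c₃ = *-cancelˡ-≡ _ _ (d C R) {{>-nonZero (d-pos R)}} (begin
      d C R * t        ≡⟨ cong (d C R *_) (sym c₁≡t) ⟩
      d C R * c₁ R S   ≡⟨ dR·c₁≡dS·c₃ hR hS ⟩
      d C S * c₃ R S   ≡⟨ cong (_* c₃ R S) (d-partner hS M≡1) ⟩
      d C R * c₃ R S   ∎)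
      where open ≡-Reasoning
    c₃≤dR : c₃ R S ≤ d C R
    c₃≤dR = subst (c₃ R S ≤_)
      (trans (outDeg-source (InRel-tr hR) (tgt-fiber hS)) (d-tr hR (trans |Y|≡m (sym (fiberCard Z fZ)))))
      (interNum≤inDeg T R (src S) (tgt S))

  valency-bound : ∀ R → R ∈ rels C Y Z → t ≤ d C R
  valency-bound R R∈ = partner-bound hR (proj₂ (nonzero-term (partner R) partners≢0))
    where
    hR : InRel C Y Z R
    hR = ∈rels⇒InRel R∈
    partners≢0 : ∑[ S < K ] partner R S ≢ 0
    partners≢0 sum≡0 = 0≢1+n (trans (sym sum≡0) (partners-sum hR))

lemma14 : ∀ {N K : ℕ} (C : Scheme N K) (m n r : ℕ) → IsMNR C m n r →
          ∀ X Y Z → IsFiber C X → IsFiber C Y → IsFiber C Z →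
          ∀ T → T ∈ rels C X Y →
          Coprime (d C T) (product (dMulti C Y Z)) →
          (dMulti C Y Z ↭ dMulti C X Z) × (∀ R → R ∈ rels C Y Z → d C T ≤ d C R)
lemma14 C m n r mnr X Y Z fX fY fZ T T∈ cop =
  same-occ⇒↭ (dMulti C Y Z) (dMulti C X Z) same-multiplicities , valency-bound
  where open Lemma14Proof C mnr fX fY fZ T∈ cop
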